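{- For all sufficiently large positive integers $n$, \[ \mathbb G^+(n)-\mathbb G^\Box(n)\le \mathbb G\left(\left\lfloor \tfrac{n}{2}\right\rfloor\right)+\mathbb G\left(\left\lfloor \tfrac{n}{3}\right\rfloor+3\right). \]
   Context: All graphs are finite, simple and unlabeled (i.e. considered up to isomorphism). $\mathbb G(n)$ denotes the number of graphs with $n$ vertices, $\mathbb G^+(n)$ the number of connected graphs with $n$ vertices, and $\mathbb G^\Box(n)$ the number of cartesian-prime graphs with $n$ vertices, where a graph is cartesian prime if it is connected, has at least two vertices, and is not isomorphic to a cartesian product $H_1\Box H_2$ of two connected graphs each having fewer vertices. The cartesian product $H_1\Box H_2$ has vertex set $V(H_1)\times V(H_2)$, with $(u_1,u_2)$ adjacent to $(v_1,v_2)$ iff either $u_1v_1\in E(H_1)$ and $u_2=v_2$, or $u_1=v_1$ and $u_2v_2\in E(H_2)$. -}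

module Defs where

open import Data.Nat using (ℕ; _<_; _≤_)
open import Data.Fin using (Fin; _≟_)
open import Data.Unit using (⊤)
open import Data.Bool using (Bool; true; false; _∧_; _∨_)
open import Data.Product using (Σ; _×_; _,_; ∃)
open import Relation.Nullary using (¬_)
open import Relation.Nullary.Decidable using (⌊_⌋)
open import Relation.Binary.PropositionalEquality using (_≡_)
open import Function.Bundles using (_↔_; Inverse)

record Graph (n : ℕ) : Set where
  field
    adj    : Fin n → Fin n → Bool
    sym    : ∀ i j → adj i j ≡ adj j i
    irrefl : ∀ i → adj i i ≡ false
open Graph public

Iso : ∀ {n} → Graph n → Graph n → Set
Iso {n} G H = Σ (Fin n ↔ Fin n) λ f →
  ∀ i j → adj G i j ≡ adj H (Inverse.to f i) (Inverse.to f j)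

data Reach {n} (G : Graph n) : Fin n → Fin n → Set where
  here : ∀ {i} → Reach G i i
  step : ∀ {i k j} → adj G i k ≡ true → Reach G k j → Reach G i j

Connected : ∀ {n} → Graph n → Set
Connected G = ∀ i j → Reach G i j

prodAdj : ∀ {a b} → Graph a → Graph b → (Fin a × Fin b) → (Fin a × Fin b) → Bool
prodAdj H₁ H₂ (u₁ , u₂) (v₁ , v₂) =
  (adj H₁ u₁ v₁ ∧ ⌊ u₂ ≟ v₂ ⌋) ∨ (⌊ u₁ ≟ v₁ ⌋ ∧ adj H₂ u₂ v₂)

IsoProd : ∀ {n a b} → Graph n → Graph a → Graph b → Set
IsoProd {n} {a} {b} G H₁ H₂ = Σ (Fin n ↔ (Fin a × Fin b)) λ f →
  ∀ i j → adj G i j ≡ prodAdj H₁ H₂ (Inverse.to f i) (Inverse.to f j)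

CartPrime : ∀ {n} → Graph n → Set
CartPrime {n} G = Connected G × 2 ≤ n ×
  ¬ (Σ ℕ λ a → Σ ℕ λ b → Σ (Graph a) λ H₁ → Σ (Graph b) λ H₂ →
       a < n × b < n × Connected H₁ × Connected H₂ × IsoProd G H₁ H₂)

AnyGraph : ∀ {n} → Graph n → Set
AnyGraph _ = ⊤

-- ClassCount P n k : the number of isomorphism classes of graphs on n vertices
-- satisfying P is k, witnessed by k pairwise non-isomorphic representatives
-- satisfying P such that every graph satisfying P is isomorphic to one of them.
record ClassCount (P : ∀ {n} → Graph n → Set) (n k : ℕ) : Set where
  field
    rep      : Fin k → Graph n
    repP     : ∀ i → P (rep i)
    distinct : ∀ i j → Iso (rep i) (rep j) → i ≡ j
    cover    : ∀ (G : Graph n) → P G → ∃ λ i → Iso G (rep i)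

-- A connected graph on n ≥ 2 vertices is either cartesian prime or isomorphic to K □ H with
-- connected factors on a, b ≥ 2 vertices, a b = n. If a = 2, then K ≅ K₂ and G is determined by H,
-- a graph on n / 2 vertices. If a, b ≥ 3, then a + b ≤ n / 3 + 3, so G is represented by the graph
-- on n / 3 + 3 vertices made of disjoint copies of K and H and isolated vertices; since K and H are
-- connected and have edges, an isomorphism between two such unions matches the two factors up to
-- order, so this graph determines G. Hence the classes of connected graphs are labelled injectively
-- by classes of prime graphs, of graphs on n / 2 and of graphs on n / 3 + 3 vertices. Being prime is
-- not decidable here, so the case split happens under a double negation, which the decidable
-- conclusion absorbs.

module Submission where

open import Defs
open import Data.Nat using (ℕ; _≤_; _+_)
open import Data.Nat.DivMod using (_/_)
open import Data.Product using (Σ)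

open import Data.Bool using (Bool; true; false; not; _∧_; _∨_)
open import Data.Bool.Properties using (∨-comm; ∧-comm)
open import Data.Fin as Fin using (Fin; _≟_)
open import Data.Fin.Properties using (+↔⊎; *↔×; injective⇒≤; cantor-schröder-bernstein)
open import Data.Maybe using (Maybe; just; nothing)
open import Data.Maybe.Properties using (just-injective)
open import Data.Nat using (zero; suc; _*_; _∸_; _<_; z≤n; s≤s; _≤?_)
open import Data.Nat.DivMod using (m*n/n≡m; /-monoˡ-≤; +-distrib-/-∣ʳ)
open import Data.Nat.Divisibility using (divides)
open import Data.Nat.Properties
  using (<⇒≤; ≤-trans; ≤-reflexive; m≤m+n; <-irrefl; *-comm; *-identityˡ; +-assoc; m+[n∸m]≡n; module ≤-Reasoning)
open import Data.Nat.Solver using (module +-*-Solver)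
open import Data.Product using (_×_; _,_; proj₁; proj₂; ∃; ∃₂)
open import Data.Product.Algebra using (×-comm)
open import Data.Product.Function.NonDependent.Propositional using (_×-↔_)
open import Data.Sum using (_⊎_; inj₁; inj₂; [_,_]′)
open import Data.Sum.Function.Propositional using (_⊎-↔_)
open import Data.Unit using (tt)
open import Function using (_∘_)
open import Function.Bundles using (_↔_; _↣_; Inverse; Injection; mk↔ₛ′; mk⇔)
open import Function.Properties.Inverse using (↔-refl; ↔-sym; ↔-trans; ↔⇒↣)
open import Relation.Nullary using (¬_; contradiction)
open import Relation.Nullary.Decidable using (⌊_⌋; does; isYes≗does; does-⇔; decidable-stable)
open import Relation.Nullary.Negation using (¬¬-map)
open import Relation.Binary.PropositionalEquality as ≡
  using (_≡_; refl; trans; cong; cong₂; subst; module ≡-Reasoning)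

Fin↔Fin⇒≡ : ∀ {m n} → Fin m ↔ Fin n → m ≡ n
Fin↔Fin⇒≡ f = cantor-schröder-bernstein
  (Injection.injective (↔⇒↣ f)) (Injection.injective (↔⇒↣ (↔-sym f)))

⊎↔Σ-Bool : (F : Bool → Set) → (F true ⊎ F false) ↔ Σ Bool F
⊎↔Σ-Bool F = mk↔ₛ′
  (λ { (inj₁ x) → true , x ; (inj₂ y) → false , y })
  (λ { (true , x) → inj₁ x ; (false , y) → inj₂ y })
  (λ { (true , _) → refl ; (false , _) → refl })
  (λ { (inj₁ _) → refl ; (inj₂ _) → refl })

¬¬-Π-Fin : ∀ {k} {Q : Fin k → Set} → (∀ i → ¬ ¬ Q i) → ¬ ¬ (∀ i → Q i)
¬¬-Π-Fin {zero}      _ ¬∀ = ¬∀ λ ()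
¬¬-Π-Fin {suc k} {Q} h ¬∀ = h Fin.zero λ q₀ → ¬¬-Π-Fin {k} {Q ∘ Fin.suc} (h ∘ Fin.suc) λ qs →
  ¬∀ λ { Fin.zero → q₀ ; (Fin.suc i) → qs i }

factor≥2 : ∀ {a b n} → a * b ≡ n → b < n → 2 ≤ a
factor≥2 {zero}        refl ()
factor≥2 {suc zero}    {b} e b<n = contradiction b<n (<-irrefl (trans (≡.sym (*-identityˡ b)) e))
factor≥2 {suc (suc _)} _   _   = s≤s (s≤s z≤n)

2*b≡n⇒n/2≡b : ∀ {b n} → 2 * b ≡ n → n / 2 ≡ b
2*b≡n⇒n/2≡b {b} e = trans (cong (_/ 2) (trans (≡.sym e) (*-comm 2 b))) (m*n/n≡m b 2)

-- From (a - 3)(b - 3) ≥ 0.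
sum≤product/3+3 : ∀ {a b} → 3 ≤ a → 3 ≤ b → a + b ≤ a * b / 3 + 3
sum≤product/3+3 {a@(suc (suc (suc a′)))} {b@(suc (suc (suc b′)))} (s≤s (s≤s (s≤s _))) (s≤s (s≤s (s≤s _))) =
  begin
    a + b                ≡⟨ ≡.sym (m*n/n≡m (a + b) 3) ⟩
    (a + b) * 3 / 3      ≤⟨ /-monoˡ-≤ 3 (≤-trans (m≤m+n ((a + b) * 3) (a′ * b′)) (≤-reflexive identity)) ⟩
    (a * b + 9) / 3      ≡⟨ +-distrib-/-∣ʳ (a * b) {9} {3} (divides 3 refl) ⟩
    a * b / 3 + 3        ∎
  where
  open ≤-Reasoning
  identity : (a + b) * 3 + a′ * b′ ≡ a * b + 9
  identity = solve 2 (λ x y → ((con 3 :+ x) :+ (con 3 :+ y)) :* con 3 :+ x :* y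
                            := (con 3 :+ x) :* (con 3 :+ y) :+ con 9) refl a′ b′
    where open +-*-Solver

-- Structures: adjacency relations on arbitrary vertex types

record Structure : Set₁ where
  field
    Carrier  : Set
    adjacent : Carrier → Carrier → Bool
open Structure

⟦_⟧ : ∀ {n} → Graph n → Structure
⟦ G ⟧ = record { Carrier = Fin _ ; adjacent = adj G }

_□_ : ∀ {a b} → Graph a → Graph b → Structure
H₁ □ H₂ = record { Carrier = Fin _ × Fin _ ; adjacent = prodAdj H₁ H₂ }

infix 4 _≅_
infixr 6 _□_

record _≅_ (A B : Structure) : Set where
  constructor mk≅
  field
    bijection : Carrier A ↔ Carrier B
  open Inverse bijection public using (to; from; strictlyInverseˡ; strictlyInverseʳ)
  field
    preserves : ∀ x y → adjacent A x y ≡ adjacent B (to x) (to y)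
open _≅_

≅-refl : ∀ {A} → A ≅ A
≅-refl = mk≅ ↔-refl λ _ _ → refl

≅-sym : ∀ {A B} → A ≅ B → B ≅ A
≅-sym {A} {B} φ = mk≅ (↔-sym (bijection φ)) λ x y → begin
    adjacent B x y
  ≡⟨ ≡.sym (cong₂ (adjacent B) (strictlyInverseˡ φ x) (strictlyInverseˡ φ y)) ⟩
    adjacent B (to φ (from φ x)) (to φ (from φ y))
  ≡⟨ ≡.sym (preserves φ _ _) ⟩
    adjacent A (from φ x) (from φ y) ∎
  where open ≡-Reasoning

≅-trans : ∀ {A B C} → A ≅ B → B ≅ C → A ≅ C
≅-trans φ ψ = mk≅ (↔-trans (bijection φ) (bijection ψ)) λ x y →
  trans (preserves φ x y) (preserves ψ _ _)

iso⇒≅ : ∀ {n} {G H : Graph n} → Iso G H → ⟦ G ⟧ ≅ ⟦ H ⟧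
iso⇒≅ (f , pres) = mk≅ f pres

≅⇒iso : ∀ {n} {G H : Graph n} → ⟦ G ⟧ ≅ ⟦ H ⟧ → Iso G H
≅⇒iso φ = bijection φ , preserves φ

isoProd⇒≅ : ∀ {n a b} {G : Graph n} {H₁ : Graph a} {H₂ : Graph b} →
            IsoProd G H₁ H₂ → ⟦ G ⟧ ≅ H₁ □ H₂
isoProd⇒≅ (f , pres) = mk≅ f pres

data Walk (A : Structure) : Carrier A → Carrier A → Set where
  here : ∀ {x} → Walk A x x
  step : ∀ {x y z} → adjacent A x y ≡ true → Walk A y z → Walk A x z

StronglyConnected : Structure → Set
StronglyConnected A = ∀ x y → Walk A x y

HasEdge : Structure → Set
HasEdge A = ∃₂ λ x y → adjacent A x y ≡ true

NontrivialConnected : Structure → Set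
NontrivialConnected A = StronglyConnected A × HasEdge A

walk-≅ : ∀ {A B} (φ : A ≅ B) {x y} → Walk A x y → Walk B (to φ x) (to φ y)
walk-≅ φ here         = here
walk-≅ φ (step e w) = step (trans (≡.sym (preserves φ _ _)) e) (walk-≅ φ w)

reach⇒walk : ∀ {n} {G : Graph n} {i j} → Reach G i j → Walk ⟦ G ⟧ i j
reach⇒walk here       = here
reach⇒walk (step e r) = step e (reach⇒walk r)

connected⇒nontrivial : ∀ {n} (G : Graph n) → 2 ≤ n → Connected G → NontrivialConnected ⟦ G ⟧
connected⇒nontrivial G (s≤s (s≤s z≤n)) conn
  with conn Fin.zero (Fin.suc Fin.zero)
... | step e _ = (λ i j → reach⇒walk (conn i j)) , _ , _ , e

record IsSimple (A : Structure) : Set where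
  field
    symmetric   : ∀ x y → adjacent A x y ≡ adjacent A y x
    irreflexive : ∀ x → adjacent A x x ≡ false

⟦⟧-simple : ∀ {n} (G : Graph n) → IsSimple ⟦ G ⟧
⟦⟧-simple G = record { symmetric = Graph.sym G ; irreflexive = irrefl G }

relabel : ∀ {m} (A : Structure) → IsSimple A → Fin m ↔ Carrier A → Graph m
relabel A simple f = record
  { adj    = λ i j → adjacent A (Inverse.to f i) (Inverse.to f j)
  ; sym    = λ i j → IsSimple.symmetric simple (Inverse.to f i) (Inverse.to f j)
  ; irrefl = λ i → IsSimple.irreflexive simple (Inverse.to f i)
  }

relabel-≅ : ∀ {m} (A : Structure) (simple : IsSimple A) (f : Fin m ↔ Carrier A) → ⟦ relabel A simple f ⟧ ≅ A
relabel-≅ A simple f = mk≅ f λ _ _ → refl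

anyGraph-class : ∀ {m k} (C : ClassCount AnyGraph m k) →
                 (A : Structure) → IsSimple A → Fin m ↔ Carrier A → ∃ λ j → A ≅ ⟦ ClassCount.rep C j ⟧
anyGraph-class C A simple f with ClassCount.cover C (relabel A simple f) tt
... | j , ι = j , ≅-trans (≅-sym (relabel-≅ A simple f))
                          (iso⇒≅ {G = relabel A simple f} {ClassCount.rep C j} ι)

-- Cartesian products

≟-invariant : ∀ {a b} (f : Fin a ↔ Fin b) u v → ⌊ u ≟ v ⌋ ≡ ⌊ Inverse.to f u ≟ Inverse.to f v ⌋
≟-invariant f u v = begin
  ⌊ u ≟ v ⌋                    ≡⟨ isYes≗does (u ≟ v) ⟩
  does (u ≟ v)                 ≡⟨ does-⇔ (mk⇔ (cong f⃗) (Injection.injective (↔⇒↣ f))) (u ≟ v) (f⃗ u ≟ f⃗ v) ⟩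
  does (f⃗ u ≟ f⃗ v)             ≡⟨ ≡.sym (isYes≗does _) ⟩
  ⌊ f⃗ u ≟ f⃗ v ⌋                ∎
  where
  open ≡-Reasoning
  f⃗ = Inverse.to f

□-cong : ∀ {a a′ b b′} {H₁ : Graph a} {H₁′ : Graph a′} {H₂ : Graph b} {H₂′ : Graph b′} →
         ⟦ H₁ ⟧ ≅ ⟦ H₁′ ⟧ → ⟦ H₂ ⟧ ≅ ⟦ H₂′ ⟧ → H₁ □ H₂ ≅ H₁′ □ H₂′
□-cong φ ψ = mk≅ (bijection φ ×-↔ bijection ψ) λ where
  (u₁ , u₂) (v₁ , v₂) → cong₂ _∨_
    (cong₂ _∧_ (preserves φ u₁ v₁) (≟-invariant (bijection ψ) u₂ v₂))
    (cong₂ _∧_ (≟-invariant (bijection φ) u₁ v₁) (preserves ψ u₂ v₂))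

□-comm : ∀ {a b} {H₁ : Graph a} {H₂ : Graph b} → H₁ □ H₂ ≅ H₂ □ H₁
□-comm {H₁ = H₁} {H₂} = mk≅ (×-comm _ _) λ
  { (u₁ , u₂) (v₁ , v₂) →
      swap-summands (adj H₁ u₁ v₁) (adj H₂ u₂ v₂) ⌊ u₁ ≟ v₁ ⌋ ⌊ u₂ ≟ v₂ ⌋ }
  where
  swap-summands : ∀ x y p q → (x ∧ q) ∨ (p ∧ y) ≡ (y ∧ p) ∨ (q ∧ x)
  swap-summands x y p q = trans (∨-comm (x ∧ q) (p ∧ y)) (cong₂ _∨_ (∧-comm p y) (∧-comm x q))

K₂ : Graph 2
K₂ = record { adj = λ i j → not ⌊ i ≟ j ⌋ ; sym = symmetric ; irrefl = irreflexive }
  where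
  symmetric : ∀ i j → not ⌊ i ≟ j ⌋ ≡ not ⌊ j ≟ i ⌋
  symmetric Fin.zero           Fin.zero           = refl
  symmetric Fin.zero           (Fin.suc Fin.zero) = refl
  symmetric (Fin.suc Fin.zero) Fin.zero           = refl
  symmetric (Fin.suc Fin.zero) (Fin.suc Fin.zero) = refl
  irreflexive : ∀ i → not ⌊ i ≟ i ⌋ ≡ false
  irreflexive Fin.zero           = refl
  irreflexive (Fin.suc Fin.zero) = refl

connected₂-≅-K₂ : (H : Graph 2) → Connected H → ⟦ H ⟧ ≅ ⟦ K₂ ⟧
connected₂-≅-K₂ H conn = mk≅ ↔-refl adjacency
  where
  edge₀₁ : adj H Fin.zero (Fin.suc Fin.zero) ≡ true
  edge₀₁ with conn Fin.zero (Fin.suc Fin.zero)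
  ... | step {k = Fin.zero}         e _ = contradiction (trans (≡.sym (irrefl H Fin.zero)) e) λ ()
  ... | step {k = Fin.suc Fin.zero} e _ = e
  adjacency : ∀ i j → adj H i j ≡ not ⌊ i ≟ j ⌋
  adjacency Fin.zero           Fin.zero           = irrefl H Fin.zero
  adjacency Fin.zero           (Fin.suc Fin.zero) = edge₀₁
  adjacency (Fin.suc Fin.zero) Fin.zero           = trans (Graph.sym H _ _) edge₀₁
  adjacency (Fin.suc Fin.zero) (Fin.suc Fin.zero) = irrefl H (Fin.suc Fin.zero)

-- Disjoint unions padded with isolated vertices

summands : Structure → Structure → Bool → Structure
summands A B true  = A
summands A B false = B

UnionCarrier : (Bool → Structure) → ℕ → Set
UnionCarrier S k = Σ Bool (Carrier ∘ S) ⊎ Fin k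

summandAdjacent : ∀ (S : Bool → Structure) c c′ → Carrier (S c) → Carrier (S c′) → Bool
summandAdjacent S true  true  = adjacent (S true)
summandAdjacent S false false = adjacent (S false)
summandAdjacent S _     _     = λ _ _ → false

unionAdjacent : ∀ (S : Bool → Structure) {k} → UnionCarrier S k → UnionCarrier S k → Bool
unionAdjacent S (inj₁ (c , x)) (inj₁ (c′ , y)) = summandAdjacent S c c′ x y
unionAdjacent S _              _               = false

padUnion : (Bool → Structure) → ℕ → Structure
padUnion S k = record { Carrier = UnionCarrier S k ; adjacent = unionAdjacent S }

side : ∀ {S k} → UnionCarrier S k → Maybe Bool
side (inj₁ (c , _)) = just c
side (inj₂ _)       = nothing

unionAdjacent-summand : ∀ S {k} c x y → unionAdjacent S {k} (inj₁ (c , x)) (inj₁ (c , y)) ≡ adjacent (S c) x y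
unionAdjacent-summand S true  x y = refl
unionAdjacent-summand S false x y = refl

edge-side : ∀ S {k} (u v : UnionCarrier S k) → unionAdjacent S u v ≡ true → side {S} u ≡ side {S} v
edge-side S (inj₁ (true , _))  (inj₁ (true , _))  _  = refl
edge-side S (inj₁ (false , _)) (inj₁ (false , _)) _  = refl
edge-side S (inj₁ (true , _))  (inj₁ (false , _)) ()
edge-side S (inj₁ (false , _)) (inj₁ (true , _))  ()
edge-side S (inj₁ _)           (inj₂ _)           ()
edge-side S (inj₂ _)           _                  ()

walk-side : ∀ {S k} {u v} → Walk (padUnion S k) u v → side {S} u ≡ side {S} v
walk-side         here                      = refl
walk-side {S} (step {x = u} {y = w} e walk) = trans (edge-side S u w e) (walk-side walk)

walk-summand : ∀ {S k c} {x y} → Walk (S c) x y → Walk (padUnion S k) (inj₁ (c , x)) (inj₁ (c , y))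
walk-summand             here       = here
walk-summand {S} {k} {c} (step e w) = step (trans (unionAdjacent-summand S {k} c _ _) e) (walk-summand w)

padUnion-simple : ∀ {S} k → (∀ c → IsSimple (S c)) → IsSimple (padUnion S k)
padUnion-simple {S} k simple = record { symmetric = symmetric ; irreflexive = irreflexive }
  where
  symmetric : ∀ u v → unionAdjacent S {k} u v ≡ unionAdjacent S v u
  symmetric (inj₁ (true , x))  (inj₁ (true , y))  = IsSimple.symmetric (simple true) x y
  symmetric (inj₁ (false , x)) (inj₁ (false , y)) = IsSimple.symmetric (simple false) x y
  symmetric (inj₁ (true , _))  (inj₁ (false , _)) = refl
  symmetric (inj₁ (false , _)) (inj₁ (true , _))  = refl
  symmetric (inj₁ _)           (inj₂ _)           = refl
  symmetric (inj₂ _)           (inj₁ _)           = refl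
  symmetric (inj₂ _)           (inj₂ _)           = refl
  irreflexive : ∀ u → unionAdjacent S {k} u u ≡ false
  irreflexive (inj₁ (c , x)) = trans (unionAdjacent-summand S {k} c x x) (IsSimple.irreflexive (simple c) x)
  irreflexive (inj₂ _)       = refl

fromSide : ∀ {S k c} (u : UnionCarrier S k) → side {S} u ≡ just c → Carrier (S c)
fromSide (inj₁ (_ , x)) refl = x

fromSide-spec : ∀ {S k c} (u : UnionCarrier S k) (p : side {S} u ≡ just c) → inj₁ (c , fromSide u p) ≡ u
fromSide-spec (inj₁ _) refl = refl

inj₁-summand-injective : ∀ {S k c} {x y : Carrier (S c)} →
                         _≡_ {A = UnionCarrier S k} (inj₁ (c , x)) (inj₁ (c , y)) → x ≡ y
inj₁-summand-injective refl = refl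

SendsSummand : ∀ {S S′ k k′} → padUnion S k ≅ padUnion S′ k′ → Bool → Bool → Set
SendsSummand {S} {S′} φ c c′ = ∀ x → side {S′} (to φ (inj₁ (c , x))) ≡ just c′

sends-summand : ∀ {S S′ k k′} (φ : padUnion S k ≅ padUnion S′ k′) c →
                NontrivialConnected (S c) → ∃ (SendsSummand φ c)
sends-summand {S} {S′} {k} φ c (conn , x₀ , y₀ , e) with to φ (inj₁ (c , x₀)) in eq
... | inj₁ (c′ , _) = c′ , λ x →
  trans (≡.sym (walk-side (walk-≅ φ (walk-summand (conn x₀ x))))) (cong (side {S′}) eq)
... | inj₂ _ = contradiction (begin
    true
  ≡⟨ ≡.sym e ⟩
    adjacent (S c) x₀ y₀
  ≡⟨ ≡.sym (unionAdjacent-summand S {k} c x₀ y₀) ⟩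
    unionAdjacent S {k} (inj₁ (c , x₀)) (inj₁ (c , y₀))
  ≡⟨ preserves φ _ _ ⟩
    unionAdjacent S′ (to φ (inj₁ (c , x₀))) (to φ (inj₁ (c , y₀)))
  ≡⟨ cong (λ u → unionAdjacent S′ u (to φ (inj₁ (c , y₀)))) eq ⟩
    false ∎) λ ()
  where open ≡-Reasoning

restrict : ∀ {S S′ k k′} (φ : padUnion S k ≅ padUnion S′ k′) {c c′} →
           SendsSummand φ c c′ → SendsSummand (≅-sym φ) c′ c → S c ≅ S′ c′
restrict {S} {S′} {k} {k′} φ {c} {c′} fwd bwd = mk≅ (mk↔ₛ′ f g f∘g g∘f) pres
  where
  f : Carrier (S c) → Carrier (S′ c′)
  f x = fromSide (to φ (inj₁ (c , x))) (fwd x)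
  g : Carrier (S′ c′) → Carrier (S c)
  g y = fromSide (from φ (inj₁ (c′ , y))) (bwd y)
  f-spec : ∀ x → inj₁ (c′ , f x) ≡ to φ (inj₁ (c , x))
  f-spec x = fromSide-spec (to φ (inj₁ (c , x))) (fwd x)
  g-spec : ∀ y → inj₁ (c , g y) ≡ from φ (inj₁ (c′ , y))
  g-spec y = fromSide-spec (from φ (inj₁ (c′ , y))) (bwd y)
  f∘g : ∀ y → f (g y) ≡ y
  f∘g y = inj₁-summand-injective {S′} {k′} (begin
    inj₁ (c′ , f (g y))            ≡⟨ f-spec (g y) ⟩
    to φ (inj₁ (c , g y))          ≡⟨ cong (to φ) (g-spec y) ⟩
    to φ (from φ (inj₁ (c′ , y)))  ≡⟨ strictlyInverseˡ φ _ ⟩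
    inj₁ (c′ , y)                  ∎)
    where open ≡-Reasoning
  g∘f : ∀ x → g (f x) ≡ x
  g∘f x = inj₁-summand-injective {S} {k} (begin
    inj₁ (c , g (f x))             ≡⟨ g-spec (f x) ⟩
    from φ (inj₁ (c′ , f x))       ≡⟨ cong (from φ) (f-spec x) ⟩
    from φ (to φ (inj₁ (c , x)))   ≡⟨ strictlyInverseʳ φ _ ⟩
    inj₁ (c , x)                   ∎)
    where open ≡-Reasoning
  pres : ∀ x y → adjacent (S c) x y ≡ adjacent (S′ c′) (f x) (f y)
  pres x y = begin
      adjacent (S c) x y
    ≡⟨ ≡.sym (unionAdjacent-summand S {k} c x y) ⟩
      unionAdjacent S {k} (inj₁ (c , x)) (inj₁ (c , y))
    ≡⟨ preserves φ _ _ ⟩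
      unionAdjacent S′ (to φ (inj₁ (c , x))) (to φ (inj₁ (c , y)))
    ≡⟨ ≡.sym (cong₂ (unionAdjacent S′) (f-spec x) (f-spec y)) ⟩
      unionAdjacent S′ {k′} (inj₁ (c′ , f x)) (inj₁ (c′ , f y))
    ≡⟨ unionAdjacent-summand S′ {k′} c′ (f x) (f y) ⟩
      adjacent (S′ c′) (f x) (f y) ∎
    where open ≡-Reasoning

summand-≅ : ∀ {S S′ k k′} (φ : padUnion S k ≅ padUnion S′ k′) →
            (∀ c → NontrivialConnected (S c)) → (∀ c → NontrivialConnected (S′ c)) →
            ∀ c → Σ Bool λ c′ → SendsSummand (≅-sym φ) c′ c × S c ≅ S′ c′
summand-≅ {S} {S′} {k} φ nontrivial nontrivial′ c with sends-summand φ c (nontrivial c)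
... | c′ , fwd with sends-summand (≅-sym φ) c′ (nontrivial′ c′)
... | c″ , bwd = c′ , bwd′ , restrict φ fwd bwd′
  where
  x₀ = proj₁ (proj₂ (nontrivial c))
  c″≡c : just c″ ≡ just c
  c″≡c = begin
      just c″
    ≡⟨ ≡.sym (bwd _) ⟩
      side {S} (from φ (inj₁ (c′ , fromSide (to φ (inj₁ (c , x₀))) _)))
    ≡⟨ cong (side {S} ∘ from φ) (fromSide-spec _ (fwd x₀)) ⟩
      side {S} (from φ (to φ (inj₁ (c , x₀))))
    ≡⟨ cong (side {S}) (strictlyInverseʳ φ _) ⟩
      just c ∎
    where open ≡-Reasoning
  bwd′ : SendsSummand (≅-sym φ) c′ c
  bwd′ y = trans (bwd y) c″≡c

sendsSummand-unique : ∀ {S S′ k k′} (φ : padUnion S k ≅ padUnion S′ k′) {c c₁ c₂} →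
                      Carrier (S c) → SendsSummand φ c c₁ → SendsSummand φ c c₂ → c₁ ≡ c₂
sendsSummand-unique φ x fwd₁ fwd₂ = just-injective (trans (≡.sym (fwd₁ x)) (fwd₂ x))

padUnion-cancel : ∀ {S S′ k k′} →
                  (∀ c → NontrivialConnected (S c)) → (∀ c → NontrivialConnected (S′ c)) →
                  padUnion S k ≅ padUnion S′ k′ → (∀ c → S c ≅ S′ c) ⊎ (∀ c → S c ≅ S′ (not c))
padUnion-cancel {S} {S′} nontrivial nontrivial′ φ
  with summand-≅ φ nontrivial nontrivial′ true | summand-≅ φ nontrivial nontrivial′ false
... | true  , _    , ι₁ | false , _    , ι₂ = inj₁ λ { true → ι₁ ; false → ι₂ }
... | false , _    , ι₁ | true  , _    , ι₂ = inj₂ λ { true → ι₁ ; false → ι₂ }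
... | true  , bwd₁ , _  | true  , bwd₂ , _  =
  contradiction (sendsSummand-unique (≅-sym φ) (proj₁ (proj₂ (nontrivial′ true))) bwd₁ bwd₂) λ ()
... | false , bwd₁ , _  | false , bwd₂ , _  =
  contradiction (sendsSummand-unique (≅-sym φ) (proj₁ (proj₂ (nontrivial′ false))) bwd₁ bwd₂) λ ()

record FactorUnion (G U : Structure) : Set where
  field
    {a b pad}     : ℕ
    K             : Graph a
    H             : Graph b
    nontrivial    : ∀ c → NontrivialConnected (summands ⟦ K ⟧ ⟦ H ⟧ c)
    factorisation : G ≅ K □ H
    union         : U ≅ padUnion (summands ⟦ K ⟧ ⟦ H ⟧) pad

factorUnion-unique : ∀ {G G′ U U′} → FactorUnion G U → FactorUnion G′ U′ → U ≅ U′ → G ≅ G′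
factorUnion-unique {G} {G′} w w′ ψ =
  [ viaSame , viaSwapped ]′ (padUnion-cancel (nontrivial w) (nontrivial w′) summandsIso)
  where
  open FactorUnion
  summandsIso = ≅-trans (≅-sym (union w)) (≅-trans ψ (union w′))
  viaSame : (∀ c → summands ⟦ K w ⟧ ⟦ H w ⟧ c ≅ summands ⟦ K w′ ⟧ ⟦ H w′ ⟧ c) → G ≅ G′
  viaSame same = ≅-trans (factorisation w) (≅-trans
    (□-cong {H₁ = K w} {K w′} {H w} {H w′} (same true) (same false))
    (≅-sym (factorisation w′)))
  viaSwapped : (∀ c → summands ⟦ K w ⟧ ⟦ H w ⟧ c ≅ summands ⟦ K w′ ⟧ ⟦ H w′ ⟧ (not c)) →
               G ≅ G′
  viaSwapped swapped = ≅-trans (factorisation w) (≅-trans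
    (□-cong {H₁ = K w} {H w′} {H w} {K w′} (swapped true) (swapped false))
    (≅-trans (□-comm {H₁ = H w′} {K w′}) (≅-sym (factorisation w′))))

-- Counting isomorphism classes

classCount-≤ : ∀ {P : ∀ {n} → Graph n → Set} {n k m} {T : Set} →
               ClassCount P n k → T ↣ Fin m → (W : Graph n → T → Set) →
               (∀ {G G′ t} → W G t → W G′ t → Iso G G′) →
               (∀ G → P G → ¬ ¬ ∃ (W G)) → k ≤ m
classCount-≤ {k = k} {m} C ι W unique label =
  decidable-stable (k ≤? m) (¬¬-map count (¬¬-Π-Fin λ i → label (rep i) (repP i)))
  where
  open ClassCount C
  count : (∀ i → ∃ (W (rep i))) → k ≤ m
  count w = injective⇒≤ {f = Injection.to ι ∘ proj₁ ∘ w} λ {i} {j} eq →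
    distinct i j (unique (proj₂ (w i)) (subst (W (rep j)) (≡.sym (Injection.injective ι eq)) (proj₂ (w j))))

Factorisation : ∀ {n} → Graph n → Set
Factorisation {n} G = Σ ℕ λ a → Σ ℕ λ b → Σ (Graph a) λ H₁ → Σ (Graph b) λ H₂ →
  a < n × b < n × Connected H₁ × Connected H₂ × IsoProd G H₁ H₂

prime-or-factorisation : ∀ {n} {G : Graph n} → 2 ≤ n → Connected G → ¬ ¬ (CartPrime G ⊎ Factorisation G)
prime-or-factorisation 2≤n conn ¬both = ¬both (inj₁ (conn , 2≤n , ¬both ∘ inj₂))

module Classification {n p g₂ g₃ : ℕ}
  (primes : ClassCount CartPrime n p)
  (halves : ClassCount AnyGraph (n / 2) g₂)
  (unions : ClassCount AnyGraph (n / 3 + 3) g₃) where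

  open ClassCount

  Witness : Graph n → Fin p ⊎ (Fin g₂ ⊎ Fin g₃) → Set
  Witness G (inj₁ j)        = ⟦ G ⟧ ≅ ⟦ rep primes j ⟧
  Witness G (inj₂ (inj₁ j)) = ⟦ G ⟧ ≅ K₂ □ rep halves j
  Witness G (inj₂ (inj₂ j)) = FactorUnion ⟦ G ⟧ ⟦ rep unions j ⟧

  witness-unique : ∀ {G G′ t} → Witness G t → Witness G′ t → Iso G G′
  witness-unique {G} {G′} {inj₁ _}        ι ι′ = ≅⇒iso {G = G} {G′} (≅-trans ι (≅-sym ι′))
  witness-unique {G} {G′} {inj₂ (inj₁ _)} ι ι′ = ≅⇒iso {G = G} {G′} (≅-trans ι (≅-sym ι′))
  witness-unique {G} {G′} {inj₂ (inj₂ _)} w w′ = ≅⇒iso {G = G} {G′} (factorUnion-unique w w′ ≅-refl)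

  k₂-witness : ∀ {G : Graph n} {b} (K : Graph 2) (H : Graph b) →
               Connected K → 2 * b ≡ n → ⟦ G ⟧ ≅ K □ H → ∃ (Witness G)
  k₂-witness {b = b} K H connK e ι =
    let j , η = anyGraph-class halves ⟦ H ⟧ (⟦⟧-simple H) relabelling
    in  inj₂ (inj₁ j) , ≅-trans ι (□-cong {H₁ = K} {K₂} {H} {rep halves j} (connected₂-≅-K₂ K connK) η)
    where
    relabelling : Fin (n / 2) ↔ Fin b
    relabelling = subst (λ m → Fin (n / 2) ↔ Fin m) (2*b≡n⇒n/2≡b e) ↔-refl

  union-witness : ∀ {G : Graph n} {a b} (K : Graph a) (H : Graph b) → 3 ≤ a → 3 ≤ b →
                  Connected K → Connected H → a * b ≡ n → ⟦ G ⟧ ≅ K □ H → ∃ (Witness G)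
  union-witness {a = a} {b} K H 3≤a 3≤b connK connH e ι =
    let j , η = anyGraph-class unions (padUnion S pad) (padUnion-simple pad simple) labelling
    in  inj₂ (inj₂ j) , record
          { K = K ; H = H ; nontrivial = nontrivial ; factorisation = ι ; union = ≅-sym η }
    where
    S = summands ⟦ K ⟧ ⟦ H ⟧
    pad = n / 3 + 3 ∸ (a + b)
    simple : ∀ c → IsSimple (S c)
    simple true  = ⟦⟧-simple K
    simple false = ⟦⟧-simple H
    nontrivial : ∀ c → NontrivialConnected (S c)
    nontrivial true  = connected⇒nontrivial K (<⇒≤ 3≤a) connK
    nontrivial false = connected⇒nontrivial H (<⇒≤ 3≤b) connH
    size : n / 3 + 3 ≡ (a + b) + pad
    size = ≡.sym (m+[n∸m]≡n (subst (λ m → a + b ≤ m / 3 + 3) e (sum≤product/3+3 3≤a 3≤b)))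
    labelling : Fin (n / 3 + 3) ↔ UnionCarrier S pad
    labelling = ↔-trans (subst (λ m → Fin (n / 3 + 3) ↔ Fin m) size ↔-refl)
                (↔-trans +↔⊎ (↔-trans +↔⊎ (⊎↔Σ-Bool (Carrier ∘ S)) ⊎-↔ ↔-refl))

  product-witness : ∀ {G : Graph n} {a b} (K : Graph a) (H : Graph b) → 2 ≤ a → 2 ≤ b →
                    Connected K → Connected H → a * b ≡ n → ⟦ G ⟧ ≅ K □ H → ∃ (Witness G)
  product-witness {a = 2} K H (s≤s (s≤s _)) (s≤s (s≤s _)) connK _ e ι = k₂-witness K H connK e ι
  product-witness {a = suc (suc (suc a))} {b = 2} K H (s≤s (s≤s _)) (s≤s (s≤s _)) _ connH e ι =
    k₂-witness H K connH (trans (*-comm 2 (suc (suc (suc a)))) e) (≅-trans ι (□-comm {H₁ = K} {H}))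
  product-witness {a = suc (suc (suc _))} {b = suc (suc (suc _))} K H (s≤s (s≤s _)) (s≤s (s≤s _)) connK connH e ι =
    union-witness K H (s≤s (s≤s (s≤s z≤n))) (s≤s (s≤s (s≤s z≤n))) connK connH e ι

  classify : (G : Graph n) → CartPrime G ⊎ Factorisation G → ∃ (Witness G)
  classify G (inj₁ prime) with cover primes G prime
  ... | j , ι = inj₁ j , iso⇒≅ {G = G} {rep primes j} ι
  classify G (inj₂ (a , b , K , H , a<n , b<n , connK , connH , ι)) =
    product-witness K H (factor≥2 ab≡n b<n) (factor≥2 (trans (*-comm b a) ab≡n) a<n) connK connH ab≡n
      (isoProd⇒≅ {G = G} {K} {H} ι)
    where
    ab≡n : a * b ≡ n
    ab≡n = Fin↔Fin⇒≡ (↔-trans *↔× (↔-sym (proj₁ ι)))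

mainTheorem1 : Σ ℕ λ N → ∀ n → N ≤ n →
    ∀ c p g₂ g₃ →
    ClassCount Connected n c →
    ClassCount CartPrime n p →
    ClassCount AnyGraph (n / 2) g₂ →
    ClassCount AnyGraph (n / 3 + 3) g₃ →
    c ≤ p + g₂ + g₃
mainTheorem1 = 2 , bound
  where
  bound : ∀ n → 2 ≤ n → ∀ c p g₂ g₃ → ClassCount Connected n c → ClassCount CartPrime n p →
          ClassCount AnyGraph (n / 2) g₂ → ClassCount AnyGraph (n / 3 + 3) g₃ → c ≤ p + g₂ + g₃
  bound n 2≤n c p g₂ g₃ connected primes halves unions =
    subst (c ≤_) (≡.sym (+-assoc p g₂ g₃))
      (classCount-≤ connected (↔⇒↣ labels) Witness witness-unique
        λ G conn → ¬¬-map (classify G) (prime-or-factorisation 2≤n conn))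
    where
    open Classification primes halves unions
    labels : (Fin p ⊎ Fin g₂ ⊎ Fin g₃) ↔ Fin (p + (g₂ + g₃))
    labels = ↔-sym (↔-trans (+↔⊎ {p} {g₂ + g₃}) (↔-refl ⊎-↔ +↔⊎ {g₂} {g₃}))
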